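{- Let $n\geq 0$ and $h\geq0$ be integers with $h\leq\lceil n/3\rceil$, and let $k\in\{1,2,3\}$ be such that $n\mathbf{e}(1)\in\Lambda_{3,k}$ (i.e. $3\mid n-k$). Then $|\Lambda_3^{(h)}\cap I(n\mathbf{e}(1))|=|\Lambda_3^{(h)}\cap\Lambda_{3,k}|$.
   Context: $\Lambda_3=\mathbb{Z}_{\geq0}^3$, $\mathbf e(1)=(1,0,0)$; $\Lambda_3^{(h)}$ is the set of $\mathbf v\in\Lambda_3$ with coordinate sum $h$. For $k\in\{1,2,3\}$, $\Lambda_{3,k}=\{(v_1,v_2,v_3)\in\Lambda_3: 3\mid v_1+2v_2+3v_3-k\}$. $X_3=\{(1,-2,0),(-2,1,0),(-1,-1,1),(0,0,-1)\}$; for $\mathbf{v},\mathbf{w}\in\Lambda_3$, $\mathbf{v}\lessdot\mathbf{w}$ iff $\mathbf{v}-\mathbf{w}\in X_3$; $\prec$ is the transitive closure of $\lessdot$ on $\Lambda_3$; $I(\mathbf v)=\{\mathbf v\}\cup\{\mathbf w\in\Lambda_3:\mathbf w\prec\mathbf v\}$. -}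

module Defs where

open import Data.Nat as ℕ using (ℕ; _+_; _*_; _≤_)
open import Data.Nat.DivMod using (_/_)
open import Data.Integer as ℤ using (ℤ; +_; -[1+_])
open import Data.Integer.Divisibility as ℤD using ()
open import Data.Product using (Σ; _×_; _,_)
open import Data.Sum using (_⊎_)
open import Data.List using (List; length)
open import Data.List.Relation.Unary.Unique.Propositional using (Unique)
open import Data.List.Membership.Propositional using (_∈_)
open import Relation.Binary.PropositionalEquality using (_≡_)
open import Relation.Binary.Construct.Closure.Transitive using (TransClosure)

Λ₃ : Set
Λ₃ = ℕ × ℕ × ℕ

ne₁ : ℕ → Λ₃
ne₁ n = (n , 0 , 0)

coordSum : Λ₃ → ℕ
coordSum (a , b , c) = a + b + c

InLevel : ℕ → Λ₃ → Set
InLevel h v = coordSum v ≡ h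

InΛ3k : ℕ → Λ₃ → Set
InΛ3k k (a , b , c) = (+ 3) ℤD.∣ ((+ (a + 2 * b + 3 * c)) ℤ.- (+ k))

ℤ³ : Set
ℤ³ = ℤ × ℤ × ℤ

_-³_ : Λ₃ → Λ₃ → ℤ³
(a , b , c) -³ (a' , b' , c') = ((+ a) ℤ.- (+ a') , (+ b) ℤ.- (+ b') , (+ c) ℤ.- (+ c'))

InX₃ : ℤ³ → Set
InX₃ x = (x ≡ (+ 1 , ℤ.- (+ 2) , + 0))
       ⊎ (x ≡ (ℤ.- (+ 2) , + 1 , + 0))
       ⊎ (x ≡ (ℤ.- (+ 1) , ℤ.- (+ 1) , + 1))
       ⊎ (x ≡ (+ 0 , + 0 , ℤ.- (+ 1)))

_⋖_ : Λ₃ → Λ₃ → Set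
v ⋖ w = InX₃ (v -³ w)

_≺_ : Λ₃ → Λ₃ → Set
_≺_ = TransClosure _⋖_

InI : Λ₃ → Λ₃ → Set
InI v w = (w ≡ v) ⊎ (w ≺ v)

⌈_/3⌉ : ℕ → ℕ
⌈ n /3⌉ = (n + 2) / 3

HasCard : (Λ₃ → Set) → ℕ → Set
HasCard P m = Σ (List Λ₃) λ L →
  Unique L × length L ≡ m × ((w : Λ₃) → (w ∈ L → P w) × (P w → w ∈ L))

-- Give (a , b , c) the weight a + 2b + 3c. Along v ⋖ w the weight is preserved or drops
-- by 3, and conversely any v of weight n − 3t climbs to n e(1): turn c into a and b,
-- then b into a, then add 3 to a via (a , 0 , 1). So I(n e(1)) is the set of vectors of
-- weight n − 3t. On level h the weight is at most 3h ≤ n + 2, where "n − 3t" is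
-- equivalent to "≡ n (mod 3)", i.e. to membership in Λ_{3,k}.
module Submission where

open import Defs
open import Data.Nat using (ℕ; _≤_)
open import Data.Product using (Σ; _×_)

open import Data.Nat as ℕ using (zero; suc; _+_; _*_; _∸_; _<_; s≤s; _≤?_)
import Data.Nat.Properties as ℕ
import Data.Nat.Divisibility as ℕ
open import Data.Nat.DivMod using (m/n*n≤m)
import Data.Nat.Tactic.RingSolver as ℕ-Solver
open import Data.Integer as ℤ using (ℤ; +_; _⊖_)
import Data.Integer.Properties as ℤ
import Data.Integer.Divisibility as ℤᵘ
import Data.Integer.Divisibility.Signed as ℤˢ
import Data.Integer.Tactic.RingSolver as ℤ-Solver
open import Data.Product using (_,_; proj₁; proj₂)
open import Data.Sum using (inj₁; inj₂)
open import Data.Empty using (⊥-elim)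
open import Data.List using (List; length; filter; cartesianProduct; upTo)
open import Data.List.Membership.Propositional using (_∈_)
open import Data.List.Membership.Propositional.Properties
  using (∈-filter⁺; ∈-filter⁻; ∈-upTo⁺; ∈-cartesianProduct⁺)
open import Data.List.Relation.Unary.Unique.Propositional using (Unique)
open import Data.List.Relation.Unary.Unique.Propositional.Properties
  using (filter⁺; upTo⁺; cartesianProduct⁺)
open import Function using (_∘_)
open import Relation.Nullary using (yes; no)
open import Relation.Nullary.Decidable using (_×-dec_)
open import Relation.Unary using (Pred; Decidable)
open import Relation.Binary.PropositionalEquality
open import Relation.Binary.Construct.Closure.Transitive as TC using ([_])

HasCard-resp : ∀ {P Q : Λ₃ → Set} {m} →
  (∀ w → P w → Q w) → (∀ w → Q w → P w) → HasCard P m → HasCard Q m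
HasCard-resp P⇒Q Q⇒P (L , unique , refl , spec) =
  L , unique , refl , λ w → (λ w∈L → P⇒Q w (proj₁ (spec w) w∈L))
                          , (λ q → proj₂ (spec w) (Q⇒P w q))

HasCard-filter : ∀ {P : Pred Λ₃ _} (P? : Decidable P) {L} →
  Unique L → (∀ w → P w → w ∈ L) → HasCard P (length (filter P? L))
HasCard-filter P? {L} unique P⊆L =
  filter P? L , filter⁺ P? unique , refl ,
  λ w → (λ w∈ → proj₂ (∈-filter⁻ P? {xs = L} w∈)) , (λ p → ∈-filter⁺ P? (P⊆L w p) p)

box : ℕ → List Λ₃
box h = cartesianProduct R (cartesianProduct R R)
  where R = upTo (suc h)

box-unique : ∀ h → Unique (box h)
box-unique h = cartesianProduct⁺ R-unique (cartesianProduct⁺ R-unique R-unique)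
  where R-unique = upTo⁺ (suc h)

level⊆box : ∀ {h} w → InLevel h w → w ∈ box h
level⊆box (a , b , c) refl =
  ∈-cartesianProduct⁺ (∈R a≤) (∈-cartesianProduct⁺ (∈R b≤) (∈R c≤))
  where
  ∈R : ∀ {x} → x ≤ a + b + c → x ∈ upTo (suc (a + b + c))
  ∈R = ∈-upTo⁺ ∘ s≤s
  a≤ : a ≤ a + b + c
  a≤ = ℕ.≤-trans (ℕ.m≤m+n a b) (ℕ.m≤m+n (a + b) c)
  b≤ : b ≤ a + b + c
  b≤ = ℕ.≤-trans (ℕ.m≤n+m b a) (ℕ.m≤m+n (a + b) c)
  c≤ : c ≤ a + b + c
  c≤ = ℕ.m≤n+m c (a + b)

+m-+n≡+d⇒m≡d+n : ∀ m n d → + m ℤ.- + n ≡ + d → m ≡ d + n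
+m-+n≡+d⇒m≡d+n m n d e = ℤ.+-injective (begin
  + m                   ≡⟨ x≡[x-y]+y (+ m) (+ n) ⟩
  (+ m ℤ.- + n) ℤ.+ + n ≡⟨ cong (ℤ._+ + n) e ⟩
  + d ℤ.+ + n           ∎)
  where
  open ≡-Reasoning
  x≡[x-y]+y : ∀ x y → x ≡ (x ℤ.- y) ℤ.+ y
  x≡[x-y]+y = ℤ-Solver.solve-∀

+m-+n≡-d⇒d+m≡n : ∀ m n d → + m ℤ.- + n ≡ ℤ.- + d → d + m ≡ n
+m-+n≡-d⇒d+m≡n m n d e = ℤ.+-injective (sym (begin
  + n                           ≡⟨ y≡-[x-y]+x (+ m) (+ n) ⟩
  ℤ.- (+ m ℤ.- + n) ℤ.+ + m     ≡⟨ cong (λ z → ℤ.- z ℤ.+ + m) e ⟩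
  ℤ.- ℤ.- + d ℤ.+ + m           ≡⟨ cong (ℤ._+ + m) (ℤ.neg-involutive (+ d)) ⟩
  + d ℤ.+ + m                   ∎))
  where
  open ≡-Reasoning
  y≡-[x-y]+x : ∀ x y → y ≡ ℤ.- (x ℤ.- y) ℤ.+ x
  y≡-[x-y]+x = ℤ-Solver.solve-∀

+[d+n]-+n≡+d : ∀ d n → + (d + n) ℤ.- + n ≡ + d
+[d+n]-+n≡+d d n = trans (cong (ℤ._- + n) (ℤ.pos-+ d n)) ([x+y]-y≡x (+ d) (+ n))
  where
  [x+y]-y≡x : ∀ x y → x ℤ.+ y ℤ.- y ≡ x
  [x+y]-y≡x = ℤ-Solver.solve-∀

+m-+[d+m]≡-d : ∀ d m → + m ℤ.- + (d + m) ≡ ℤ.- + d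
+m-+[d+m]≡-d d m = trans (cong (λ z → + m ℤ.- z) (ℤ.pos-+ d m)) (y-[x+y]≡-x (+ d) (+ m))
  where
  y-[x+y]≡-x : ∀ x y → y ℤ.- (x ℤ.+ y) ≡ ℤ.- x
  y-[x+y]≡-x = ℤ-Solver.solve-∀

×³-injective : ∀ {x y z x' y' z' : ℤ} → (x , y , z) ≡ (x' , y' , z') → x ≡ x' × y ≡ y' × z ≡ z'
×³-injective refl = refl , refl , refl

data Move : Λ₃ → Λ₃ → Set where
  a-from-b  : ∀ a b c → Move (suc a , b , c) (a , 2 + b , c)
  b-from-a  : ∀ a b c → Move (a , suc b , c) (2 + a , b , c)
  c-from-ab : ∀ a b c → Move (a , b , suc c) (suc a , suc b , c)
  drop-c    : ∀ a b c → Move (a , b , c) (a , b , suc c)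

⋖⇒Move : ∀ {v w} → v ⋖ w → Move v w
⋖⇒Move {a , b , c} {a' , b' , c'} (inj₁ e) with ×³-injective e
... | e₁ , e₂ , e₃
  with +m-+n≡+d⇒m≡d+n a a' 1 e₁ | +m-+n≡-d⇒d+m≡n b b' 2 e₂ | +m-+n≡+d⇒m≡d+n c c' 0 e₃
... | refl | refl | refl = a-from-b a' b c'
⋖⇒Move {a , b , c} {a' , b' , c'} (inj₂ (inj₁ e)) with ×³-injective e
... | e₁ , e₂ , e₃
  with +m-+n≡-d⇒d+m≡n a a' 2 e₁ | +m-+n≡+d⇒m≡d+n b b' 1 e₂ | +m-+n≡+d⇒m≡d+n c c' 0 e₃
... | refl | refl | refl = b-from-a a b' c'
⋖⇒Move {a , b , c} {a' , b' , c'} (inj₂ (inj₂ (inj₁ e))) with ×³-injective e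
... | e₁ , e₂ , e₃
  with +m-+n≡-d⇒d+m≡n a a' 1 e₁ | +m-+n≡-d⇒d+m≡n b b' 1 e₂ | +m-+n≡+d⇒m≡d+n c c' 1 e₃
... | refl | refl | refl = c-from-ab a b c'
⋖⇒Move {a , b , c} {a' , b' , c'} (inj₂ (inj₂ (inj₂ e))) with ×³-injective e
... | e₁ , e₂ , e₃
  with +m-+n≡+d⇒m≡d+n a a' 0 e₁ | +m-+n≡+d⇒m≡d+n b b' 0 e₂ | +m-+n≡-d⇒d+m≡n c c' 1 e₃
... | refl | refl | refl = drop-c a' b' c

Move⇒⋖ : ∀ {v w} → Move v w → v ⋖ w
Move⇒⋖ (a-from-b a b c) = inj₁
  (cong₂ _,_ (+[d+n]-+n≡+d 1 a) (cong₂ _,_ (+m-+[d+m]≡-d 2 b) (+[d+n]-+n≡+d 0 c)))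
Move⇒⋖ (b-from-a a b c) = inj₂ (inj₁
  (cong₂ _,_ (+m-+[d+m]≡-d 2 a) (cong₂ _,_ (+[d+n]-+n≡+d 1 b) (+[d+n]-+n≡+d 0 c))))
Move⇒⋖ (c-from-ab a b c) = inj₂ (inj₂ (inj₁
  (cong₂ _,_ (+m-+[d+m]≡-d 1 a) (cong₂ _,_ (+m-+[d+m]≡-d 1 b) (+[d+n]-+n≡+d 1 c)))))
Move⇒⋖ (drop-c a b c) = inj₂ (inj₂ (inj₂
  (cong₂ _,_ (+[d+n]-+n≡+d 0 a) (cong₂ _,_ (+[d+n]-+n≡+d 0 b) (+m-+[d+m]≡-d 1 c)))))

weight : Λ₃ → ℕ
weight (a , b , c) = a + 2 * b + 3 * c

_≼₃_ : ℕ → ℕ → Set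
m ≼₃ n = Σ ℕ λ t → m + 3 * t ≡ n

≼₃-refl : ∀ n → n ≼₃ n
≼₃-refl n = 0 , ℕ.+-identityʳ n

≼₃-trans : ∀ {l m n} → l ≼₃ m → m ≼₃ n → l ≼₃ n
≼₃-trans {l} (s , refl) (t , refl) = s + t , split l s t
  where
  split : ∀ l s t → l + 3 * (s + t) ≡ l + 3 * s + 3 * t
  split = ℕ-Solver.solve-∀

Move-weight : ∀ {v w} → Move v w → weight v ≼₃ weight w
Move-weight (a-from-b a b c)  = 1 , a-from-b-weight a b c
  where
  a-from-b-weight : ∀ a b c → suc a + 2 * b + 3 * c + 3 * 1 ≡ a + 2 * (2 + b) + 3 * c
  a-from-b-weight = ℕ-Solver.solve-∀
Move-weight (b-from-a a b c)  = 0 , b-from-a-weight a b c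
  where
  b-from-a-weight : ∀ a b c → a + 2 * suc b + 3 * c + 3 * 0 ≡ 2 + a + 2 * b + 3 * c
  b-from-a-weight = ℕ-Solver.solve-∀
Move-weight (c-from-ab a b c) = 0 , c-from-ab-weight a b c
  where
  c-from-ab-weight : ∀ a b c → a + 2 * b + 3 * suc c + 3 * 0 ≡ suc a + 2 * suc b + 3 * c
  c-from-ab-weight = ℕ-Solver.solve-∀
Move-weight (drop-c a b c)    = 1 , drop-c-weight a b c
  where
  drop-c-weight : ∀ a b c → a + 2 * b + 3 * c + 3 * 1 ≡ a + 2 * b + 3 * suc c
  drop-c-weight = ℕ-Solver.solve-∀

⋖-weight : ∀ v w → v ⋖ w → weight v ≼₃ weight w
⋖-weight v w v⋖w = Move-weight (⋖⇒Move {v} {w} v⋖w)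

≺-weight : ∀ {v w} → v ≺ w → weight v ≼₃ weight w
≺-weight {v} {w} [ v⋖w ] = ⋖-weight v w v⋖w
≺-weight {v} (TC._∷_ {y = u} v⋖u u≺w) = ≼₃-trans {weight v} (⋖-weight v u v⋖u) (≺-weight u≺w)

weight-ne₁ : ∀ n → weight (ne₁ n) ≡ n
weight-ne₁ n = trans (ℕ.+-identityʳ (n + 0)) (ℕ.+-identityʳ n)

InI-ne₁⇒≼₃ : ∀ {n} w → InI (ne₁ n) w → weight w ≼₃ n
InI-ne₁⇒≼₃ {n} w w∈I = subst (weight w ≼₃_) (weight-ne₁ n) (lemma w∈I)
  where
  lemma : InI (ne₁ n) w → weight w ≼₃ weight (ne₁ n)
  lemma (inj₁ refl) = ≼₃-refl (weight w)
  lemma (inj₂ w≺) = ≺-weight w≺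

⋖-InI : ∀ {v u w} → w ⋖ u → InI v u → InI v w
⋖-InI w⋖u (inj₁ refl) = inj₂ [ w⋖u ]
⋖-InI w⋖u (inj₂ u≺v)  = inj₂ (w⋖u TC.∷ u≺v)

≼₃⇒InI-ne₁ : ∀ {n} w → weight w ≼₃ n → InI (ne₁ n) w
≼₃⇒InI-ne₁ (a , b , c) (t , e) = ascend t c b a e
  where
  ascend : ∀ t c b a {n} → weight (a , b , c) + 3 * t ≡ n → InI (ne₁ n) (a , b , c)
  ascend t (suc c) b a e =
    ⋖-InI (Move⇒⋖ (c-from-ab a b c)) (ascend t c (suc b) (suc a) (trans (shift a b c t) e))
    where
    shift : ∀ a b c t → suc a + 2 * suc b + 3 * c + 3 * t ≡ a + 2 * b + 3 * suc c + 3 * t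
    shift = ℕ-Solver.solve-∀
  ascend t zero (suc b) a e =
    ⋖-InI (Move⇒⋖ (b-from-a a b 0)) (ascend t zero b (2 + a) (trans (shift a b t) e))
    where
    shift : ∀ a b t → 2 + a + 2 * b + 3 * 0 + 3 * t ≡ a + 2 * suc b + 3 * 0 + 3 * t
    shift = ℕ-Solver.solve-∀
  ascend (suc t) zero zero a e =
    ⋖-InI (Move⇒⋖ (drop-c a 0 0)) (ascend t 1 0 a (trans (shift a t) e))
    where
    shift : ∀ a t → a + 2 * 0 + 3 * 1 + 3 * t ≡ a + 2 * 0 + 3 * 0 + 3 * suc t
    shift = ℕ-Solver.solve-∀
  ascend zero zero zero a e = inj₁ (cong ne₁ (trans (base a) e))
    where
    base : ∀ a → a ≡ a + 2 * 0 + 3 * 0 + 3 * 0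
    base = ℕ-Solver.solve-∀

≼₃-resp-∣ : ∀ {m n k} → m ≼₃ n → + 3 ℤᵘ.∣ + n ℤ.- + k → + 3 ℤᵘ.∣ + m ℤ.- + k
≼₃-resp-∣ {m} {k = k} (t , refl) 3∣n-k = ℤˢ.∣⇒∣ᵤ {i = + m ℤ.- + k} (ℤˢ.∣m+n∣n⇒∣m 3∣[m-k]+3t 3∣3t)
  where
  3∣3t : + 3 ℤˢ.∣ + (3 * t)
  3∣3t = ℤˢ.∣ᵤ⇒∣ (ℕ.m∣m*n t)
  regroup : + (m + 3 * t) ℤ.- + k ≡ (+ m ℤ.- + k) ℤ.+ + (3 * t)
  regroup = trans (cong (ℤ._- + k) (ℤ.pos-+ m (3 * t))) ([x+y]-z≡[x-z]+y (+ m) (+ (3 * t)) (+ k))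
    where
    [x+y]-z≡[x-z]+y : ∀ x y z → (x ℤ.+ y) ℤ.- z ≡ (x ℤ.- z) ℤ.+ y
    [x+y]-z≡[x-z]+y = ℤ-Solver.solve-∀
  3∣[m-k]+3t : + 3 ℤˢ.∣ (+ m ℤ.- + k) ℤ.+ + (3 * t)
  3∣[m-k]+3t = subst (+ 3 ℤˢ.∣_) regroup (ℤˢ.∣ᵤ⇒∣ {i = + (m + 3 * t) ℤ.- + k} 3∣n-k)

∣⊖∣⇒≼₃ : ∀ {m n} → 3 ℕ.∣ ℤ.∣ n ⊖ m ∣ → m ≤ n + 2 → m ≼₃ n
∣⊖∣⇒≼₃ {m} {n} 3∣ m≤n+2 with m ≤? n
... | yes m≤n with subst (3 ℕ.∣_) (cong ℤ.∣_∣ (ℤ.⊖-≥ m≤n)) 3∣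
...   | ℕ.divides t n∸m≡t*3 = t , (begin
  m + 3 * t     ≡⟨ cong (λ x → m + x) (trans (ℕ.*-comm 3 t) (sym n∸m≡t*3)) ⟩
  m + (n ∸ m)   ≡⟨ ℕ.m+[n∸m]≡n m≤n ⟩
  n             ∎)
  where open ≡-Reasoning
∣⊖∣⇒≼₃ {m} {n} 3∣ m≤n+2 | no m≰n = ⊥-elim (ℕ.≤⇒≯ m∸n≤2 (ℕ.∣⇒≤ ⦃ ℕ.>-nonZero 0<m∸n ⦄ 3∣m∸n))
  where
  n<m : n < m
  n<m = ℕ.≰⇒> m≰n
  3∣m∸n : 3 ℕ.∣ m ∸ n
  3∣m∸n = subst (3 ℕ.∣_) (ℤ.∣⊖∣-< n<m) 3∣
  0<m∸n : 0 < m ∸ n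
  0<m∸n = ℕ.m<n⇒0<n∸m n<m
  m∸n≤2 : m ∸ n ≤ 2
  m∸n≤2 = ℕ.m≤n+o⇒m∸n≤o m n m≤n+2

∣⇒≼₃ : ∀ {m n k} → + 3 ℤᵘ.∣ + m ℤ.- + k → + 3 ℤᵘ.∣ + n ℤ.- + k → m ≤ n + 2 → m ≼₃ n
∣⇒≼₃ {m} {n} {k} 3∣m-k 3∣n-k = ∣⊖∣⇒≼₃ (ℤˢ.∣⇒∣ᵤ (subst (+ 3 ℤˢ.∣_) cancel
  (ℤˢ.∣m∣n⇒∣m-n (ℤˢ.∣ᵤ⇒∣ {i = + n ℤ.- + k} 3∣n-k) (ℤˢ.∣ᵤ⇒∣ {i = + m ℤ.- + k} 3∣m-k))))
  where
  cancel : (+ n ℤ.- + k) ℤ.- (+ m ℤ.- + k) ≡ n ⊖ m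
  cancel = trans ([x-z]-[y-z]≡x-y (+ n) (+ m) (+ k)) (ℤ.m-n≡m⊖n n m)
    where
    [x-z]-[y-z]≡x-y : ∀ x y z → (x ℤ.- z) ℤ.- (y ℤ.- z) ≡ x ℤ.- y
    [x-z]-[y-z]≡x-y = ℤ-Solver.solve-∀

weight≤3*coordSum : ∀ v → weight v ≤ 3 * coordSum v
weight≤3*coordSum (a , b , c) =
  subst (a + 2 * b + 3 * c ≤_) (regroup a b c) (ℕ.m≤m+n _ (2 * a + b))
  where
  regroup : ∀ a b c → a + 2 * b + 3 * c + (2 * a + b) ≡ 3 * (a + b + c)
  regroup = ℕ-Solver.solve-∀

3*⌈n/3⌉≤n+2 : ∀ n → 3 * ⌈ n /3⌉ ≤ n + 2
3*⌈n/3⌉≤n+2 n = subst (_≤ n + 2) (ℕ.*-comm ⌈ n /3⌉ 3) (m/n*n≤m (n + 2) 3)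

weight-bound : ∀ {h n} w → InLevel h w → h ≤ ⌈ n /3⌉ → weight w ≤ n + 2
weight-bound {n = n} w refl h≤⌈n/3⌉ =
  ℕ.≤-trans (weight≤3*coordSum w) (ℕ.≤-trans (ℕ.*-monoʳ-≤ 3 h≤⌈n/3⌉) (3*⌈n/3⌉≤n+2 n))

InLevel? : ∀ h → Decidable (InLevel h)
InLevel? h v = coordSum v ℕ.≟ h

InΛ3k? : ∀ k → Decidable (InΛ3k k)
InΛ3k? k (a , b , c) = 3 ℕ.∣? ℤ.∣ + (a + 2 * b + 3 * c) ℤ.- + k ∣

proposition3p3 : (n h k : ℕ) → h ≤ ⌈ n /3⌉ → 1 ≤ k → k ≤ 3 → InΛ3k k (ne₁ n) →
    Σ ℕ (λ m → HasCard (λ w → InLevel h w × InI (ne₁ n) w) m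
    × HasCard (λ w → InLevel h w × InΛ3k k w) m)
proposition3p3 n h k h≤⌈n/3⌉ _ _ n∈Λ₃ₖ =
  length (filter P? (box h)) , HasCard-resp to from card , card
  where
  P? : Decidable (λ w → InLevel h w × InΛ3k k w)
  P? w = InLevel? h w ×-dec InΛ3k? k w
  card : HasCard (λ w → InLevel h w × InΛ3k k w) (length (filter P? (box h)))
  card = HasCard-filter P? (box-unique h) (λ w → level⊆box w ∘ proj₁)
  3∣n-k : + 3 ℤᵘ.∣ + n ℤ.- + k
  3∣n-k = subst (λ m → + 3 ℤᵘ.∣ + m ℤ.- + k) (weight-ne₁ n) n∈Λ₃ₖ
  to : ∀ w → InLevel h w × InΛ3k k w → InLevel h w × InI (ne₁ n) w
  to w@(_ , _ , _) (lev , w∈Λ₃ₖ) =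
    lev , ≼₃⇒InI-ne₁ w (∣⇒≼₃ {k = k} w∈Λ₃ₖ 3∣n-k (weight-bound w lev h≤⌈n/3⌉))
  from : ∀ w → InLevel h w × InI (ne₁ n) w → InLevel h w × InΛ3k k w
  from w@(_ , _ , _) (lev , w∈I) = lev , ≼₃-resp-∣ {weight w} {k = k} (InI-ne₁⇒≼₃ w w∈I) 3∣n-k
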